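{- For $x \in \mathbb{C}$ and $n\in\mathbb{N}_0$, $$\sum_{k=1}^n k^4 H_k^{(2)}(x) = \frac{6x^5 + 15x^4 + 10x^3 - x - n + 10n^3 + 15n^4 + 6n^5}{30} H_n^{(2)}(x) - \frac{30x^2(x+1)^2 - 1}{30} H_n(x) + \frac{(48x^3 + 72x^2 - 18nx^2 + 14x - 18nx + 8n^2x - 5 + 2n + 4n^2 - 3n^3)n}{60}.$$
   Context: For $x\in\mathbb{C}$, $l,n\in\mathbb{N}_0$, $H_0^{(l)}(x)=0$ and $H_n^{(l)}(x)=\sum_{k=1}^n \frac{1}{(x+k)^l}$ for $n\ge 1$ (defined whenever $x$ is not one of $-1,\dots,-n$); $H_n(x)=H_n^{(1)}(x)$. -}

module Defs where

import Level
open import Level using (_⊔_)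
open import Data.Nat using (ℕ; zero; suc)
open import Algebra.Bundles using (CommutativeRing)
open import Relation.Nullary using (¬_)

module RingOps {c ℓ} (R : CommutativeRing c ℓ) where
  open CommutativeRing R

  infixl 6 _−_
  infixr 8 _^_

  ι : ℕ → Carrier
  ι zero    = 0#
  ι (suc n) = 1# + ι n

  _−_ : Carrier → Carrier → Carrier
  a − b = a + (- b)

  _^_ : Carrier → ℕ → Carrier
  a ^ zero  = 1#
  a ^ suc n = a * (a ^ n)

  Σ₁ : ℕ → (ℕ → Carrier) → Carrier
  Σ₁ zero    f = 0#
  Σ₁ (suc n) f = Σ₁ n f + f (suc n)

-- A field of characteristic 0 (the stdlib has no Field bundle):
-- a commutative ring with 0 ≠ 1, a multiplicative inverse for every
-- nonzero element, and n·1 ≠ 0 for every n ≥ 1.  ℂ is an instance.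
record CharZeroField c ℓ : Set (Level.suc (c ⊔ ℓ)) where
  field
    commutativeRing : CommutativeRing c ℓ
  open CommutativeRing commutativeRing public
  open RingOps commutativeRing public
  field
    _⁻¹        : Carrier → Carrier
    0≉1        : ¬ (0# ≈ 1#)
    ⁻¹-inverse : ∀ y → ¬ (y ≈ 0#) → y * (y ⁻¹) ≈ 1#
    char0      : ∀ n → ¬ (ι (suc n) ≈ 0#)

module Harmonic {c ℓ} (F : CharZeroField c ℓ) where
  open CharZeroField F

  H^ : ℕ → ℕ → Carrier → Carrier
  H^ l n x = Σ₁ n (λ k → ((x + ι k) ^ l) ⁻¹)

  H : ℕ → Carrier → Carrier
  H n x = H^ 1 n x

module Submission where

-- Write N = ι n, h₂ = H_n^{(2)}(x), h₁ = H_n(x) and let A(x,N), C(x), B(x,N)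
-- be the three polynomials of the statement.  The identity is equivalent to
--   60 · Σ_{k=1}^n k⁴ H_k^{(2)}(x)  =  2A(x,N)·h₂ − 2C(x)·h₁ + B(x,N),
-- and the right-hand side, call it G(n), is proved to be a telescoping
-- antiderivative of 60 k⁴ H_k^{(2)}(x): G(0) = 0 and
--   G(n+1) = G(n) + 60 (n+1)⁴ H_{n+1}^{(2)}(x).
-- Passing from n to n+1 adds w = 1/Y² to h₂ and v = 1/Y to h₁ (Y = x+n+1),
-- so the step reduces to two polynomial identities in x and N:
--   2A(x,N+1) = 2A(x,N) + 60(N+1)⁴            (coefficient of h₂), and
--   2A(x,N) − 2C(x)·Y + (B(x,N+1) − B(x,N))·Y² = 0   (the rest, after
--   clearing the denominators Y and Y²),
-- both checked by the ring solver with integer coefficients.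

open import Defs
open import Data.Nat as ℕ using (ℕ; zero; suc; _≤_; _<_; s≤s; z≤n)
import Data.Nat.Properties as ℕP
open import Data.Integer as ℤ using (ℤ; +_; -[1+_])
import Data.Integer.Properties as ℤP
open import Data.Maybe using (Maybe; just; nothing)
open import Data.Vec using ([]; _∷_)
import Data.Fin as Fin
open import Algebra.Bundles using (CommutativeRing)
import Algebra.Properties.Ring as RingProperties
import Algebra.Properties.Semiring.Mult as SemiringMult
import Algebra.Solver.Ring.AlmostCommutativeRing as ACR
open import Relation.Binary.PropositionalEquality as ≡ using (_≡_)
open import Relation.Nullary using (¬_; yes; no)

module IntegerSolver {c ℓ} (R : CommutativeRing c ℓ) where
  open CommutativeRing R
  open RingOps R
  open RingProperties ring
  open SemiringMult semiring using (_×_; ×-homo-+; ×1-homo-*)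
  open import Relation.Binary.Reasoning.Setoid setoid

  -- ι is the library's n × 1#, so it inherits additivity and multiplicativity.
  ι≡×1 : ∀ n → ι n ≡ n × 1#
  ι≡×1 zero    = ≡.refl
  ι≡×1 (suc n) = ≡.cong (λ t → 1# + t) (ι≡×1 n)

  ι-+ : ∀ m n → ι (m ℕ.+ n) ≈ ι m + ι n
  ι-+ m n = begin
    ι (m ℕ.+ n)       ≡⟨ ι≡×1 (m ℕ.+ n) ⟩
    (m ℕ.+ n) × 1#    ≈⟨ ×-homo-+ 1# m n ⟩
    m × 1# + n × 1#   ≡⟨ ≡.sym (≡.cong₂ _+_ (ι≡×1 m) (ι≡×1 n)) ⟩
    ι m + ι n         ∎

  ι-* : ∀ m n → ι (m ℕ.* n) ≈ ι m * ι n
  ι-* m n = begin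
    ι (m ℕ.* n)         ≡⟨ ι≡×1 (m ℕ.* n) ⟩
    (m ℕ.* n) × 1#      ≈⟨ ×1-homo-* m n ⟩
    (m × 1#) * (n × 1#) ≡⟨ ≡.sym (≡.cong₂ _*_ (ι≡×1 m) (ι≡×1 n)) ⟩
    ι m * ι n           ∎

  ιℤ : ℤ → Carrier
  ιℤ (+ n)    = ι n
  ιℤ -[1+ n ] = - ι (suc n)

  cancel-1# : ∀ a b → (1# + a) − (1# + b) ≈ a − b
  cancel-1# a b = begin
    (1# + a) + - (1# + b)    ≈⟨ +-congˡ (sym (-‿+-comm 1# b)) ⟩
    (1# + a) + (- 1# + - b)  ≈⟨ +-congʳ (+-comm 1# a) ⟩
    (a + 1#) + (- 1# + - b)  ≈⟨ +-assoc a 1# _ ⟩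
    a + (1# + (- 1# + - b))  ≈⟨ +-congˡ (sym (+-assoc 1# (- 1#) (- b))) ⟩
    a + ((1# + - 1#) + - b)  ≈⟨ +-congˡ (+-congʳ (-‿inverseʳ 1#)) ⟩
    a + (0# + - b)           ≈⟨ +-congˡ (+-identityˡ (- b)) ⟩
    a + - b                  ∎

  ιℤ-⊖ : ∀ m n → ιℤ (m ℤ.⊖ n) ≈ ι m − ι n
  ιℤ-⊖ zero    zero    = sym (trans (+-congˡ -0#≈0#) (+-identityʳ 0#))
  ιℤ-⊖ (suc m) zero    = sym (trans (+-congˡ -0#≈0#) (+-identityʳ _))
  ιℤ-⊖ zero    (suc n) = sym (+-identityˡ _)
  ιℤ-⊖ (suc m) (suc n) = begin
    ιℤ (suc m ℤ.⊖ suc n)       ≡⟨ ≡.cong ιℤ (ℤP.[1+m]⊖[1+n]≡m⊖n m n) ⟩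
    ιℤ (m ℤ.⊖ n)               ≈⟨ ιℤ-⊖ m n ⟩
    ι m − ι n                  ≈⟨ sym (cancel-1# (ι m) (ι n)) ⟩
    (1# + ι m) − (1# + ι n)    ∎

  ιℤ-+ : ∀ i j → ιℤ (i ℤ.+ j) ≈ ιℤ i + ιℤ j
  ιℤ-+ (+ m)    (+ n)    = ι-+ m n
  ιℤ-+ (+ m)    -[1+ n ] = ιℤ-⊖ m (suc n)
  ιℤ-+ -[1+ m ] (+ n)    = trans (ιℤ-⊖ n (suc m)) (+-comm _ _)
  ιℤ-+ -[1+ m ] -[1+ n ] = begin
    - ι (suc (suc (m ℕ.+ n)))  ≡⟨ ≡.cong (λ k → - ι k) (≡.sym (ℕP.+-suc (suc m) n)) ⟩
    - ι (suc m ℕ.+ suc n)      ≈⟨ -‿cong (ι-+ (suc m) (suc n)) ⟩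
    - (ι (suc m) + ι (suc n))  ≈⟨ sym (-‿+-comm _ _) ⟩
    - ι (suc m) + - ι (suc n)  ∎

  ιℤ-* : ∀ i j → ιℤ (i ℤ.* j) ≈ ιℤ i * ιℤ j
  ιℤ-* (+ zero)   j          = sym (zeroˡ _)
  ιℤ-* i          (+ zero)   = trans (reflexive (≡.cong ιℤ (ℤP.*-zeroʳ i))) (sym (zeroʳ _))
  ιℤ-* (+ suc m)  (+ suc n)  = ι-* (suc m) (suc n)
  ιℤ-* (+ suc m)  -[1+ n ]   = trans (-‿cong (ι-* (suc m) (suc n))) (-‿distribʳ-* _ _)
  ιℤ-* -[1+ m ]   (+ suc n)  = trans (-‿cong (ι-* (suc m) (suc n))) (-‿distribˡ-* _ _)
  ιℤ-* -[1+ m ]   -[1+ n ]   = begin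
    ι (suc m ℕ.* suc n)        ≈⟨ ι-* (suc m) (suc n) ⟩
    ι (suc m) * ι (suc n)      ≈⟨ sym (-‿involutive _) ⟩
    - - (ι (suc m) * ι (suc n)) ≈⟨ -‿cong (-‿distribˡ-* _ _) ⟩
    - (- ι (suc m) * ι (suc n)) ≈⟨ -‿distribʳ-* _ _ ⟩
    - ι (suc m) * - ι (suc n)  ∎

  ιℤ-- : ∀ i → ιℤ (ℤ.- i) ≈ - ιℤ i
  ιℤ-- (+ zero)  = sym -0#≈0#
  ιℤ-- (+ suc n) = refl
  ιℤ-- -[1+ n ]  = sym (-‿involutive _)

  ιℤ-morphism : ℤ.+-*-rawRing ACR.-Raw-AlmostCommutative⟶ ACR.fromCommutativeRing R
  ιℤ-morphism = record
    { ⟦_⟧ = ιℤ ; +-homo = ιℤ-+ ; *-homo = ιℤ-* ; -‿homo = ιℤ--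
    ; 0-homo = refl ; 1-homo = +-identityʳ 1# }

  ιℤ-equal? : ∀ i j → Maybe (ιℤ i ≈ ιℤ j)
  ιℤ-equal? i j with i ℤ.≟ j
  ... | yes ≡.refl = just refl
  ... | no _       = nothing

  open import Algebra.Solver.Ring ℤ.+-*-rawRing (ACR.fromCommutativeRing R) ιℤ-morphism ιℤ-equal?
    public

module RingLemmas {c ℓ} (R : CommutativeRing c ℓ) where
  open CommutativeRing R
  open RingOps R
  open IntegerSolver R
  open import Relation.Binary.Reasoning.Setoid setoid

  Σ₁-telescope : (f F : ℕ → Carrier) → F 0 ≈ 0# → ∀ n →
    (∀ k → k < n → F (suc k) ≈ F k + f (suc k)) → Σ₁ n f ≈ F n
  Σ₁-telescope f F F0≈0 zero    step = sym F0≈0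
  Σ₁-telescope f F F0≈0 (suc n) step = begin
    Σ₁ n f + f (suc n)  ≈⟨ +-congʳ (Σ₁-telescope f F F0≈0 n (λ k k<n → step k (ℕP.m<n⇒m<1+n k<n))) ⟩
    F n + f (suc n)     ≈⟨ sym (step n ℕP.≤-refl) ⟩
    F (suc n)           ∎

  Σ₁-*ˡ : ∀ a n (f : ℕ → Carrier) → Σ₁ n (λ k → a * f k) ≈ a * Σ₁ n f
  Σ₁-*ˡ a zero    f = sym (zeroʳ a)
  Σ₁-*ˡ a (suc n) f = trans (+-congʳ (Σ₁-*ˡ a n f)) (sym (distribˡ a (Σ₁ n f) (f (suc n))))

  partial-fractions : ∀ {Y v w D Q E} → Y ^ 1 * v ≈ 1# → Y ^ 2 * w ≈ 1# →
    D − Q * Y + E * Y ^ 2 ≈ 0# → D * w − Q * v + E ≈ 0#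
  partial-fractions {Y} {v} {w} {D} {Q} {E} Yv≈1 Y²w≈1 numerator≈0 = begin
    D * w − Q * v + E                  ≈⟨ +-cong (+-congˡ (-‿cong (*-congˡ (sym wY≈v))))
                                                 (sym (trans (*-congˡ Y²w≈1) (*-identityʳ E))) ⟩
    D * w − Q * (w * Y) + E * (Y ^ 2 * w) ≈⟨ factor-w D Q E Y w ⟩
    w * (D − Q * Y + E * Y ^ 2)        ≈⟨ *-congˡ numerator≈0 ⟩
    w * 0#                             ≈⟨ zeroʳ w ⟩
    0#                                 ∎
    where
    factor-w : ∀ D Q E Y w → D * w − Q * (w * Y) + E * (Y ^ 2 * w) ≈ w * (D − Q * Y + E * Y ^ 2)
    factor-w = solve 5 (λ D Q E Y w →
      D :* w :- Q :* (w :* Y) :+ E :* (Y :^ 2 :* w) := w :* (D :- Q :* Y :+ E :* Y :^ 2)) refl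

    wY≈v : w * Y ≈ v
    wY≈v = begin
      w * Y                ≈⟨ sym (trans (*-congˡ Yv≈1) (*-identityʳ (w * Y))) ⟩
      (w * Y) * (Y ^ 1 * v) ≈⟨ solve 3 (λ Y v w → (w :* Y) :* (Y :^ 1 :* v) := (Y :^ 2 :* w) :* v) refl Y v w ⟩
      (Y ^ 2 * w) * v      ≈⟨ trans (*-congʳ Y²w≈1) (*-identityˡ v) ⟩
      v                    ∎

  closed-form-step : ∀ {P P′ Q B B′ a b h₁ h₂ v w} → P′ ≈ P + a * b →
    P * w − Q * v + (B′ − B) ≈ 0# →
    P′ * (h₂ + w) − Q * (h₁ + v) + B′ ≈ (P * h₂ − Q * h₁ + B) + a * (b * (h₂ + w))
  closed-form-step {P} {P′} {Q} {B} {B′} {a} {b} {h₁} {h₂} {v} {w} P′≈P+ab rest≈0 = begin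
    P′ * (h₂ + w) − Q * (h₁ + v) + B′
      ≈⟨ +-congʳ (+-congʳ (*-congʳ P′≈P+ab)) ⟩
    (P + a * b) * (h₂ + w) − Q * (h₁ + v) + B′
      ≈⟨ regroup P Q B B′ a b h₁ h₂ v w ⟩
    (P * h₂ − Q * h₁ + B + a * (b * (h₂ + w))) + (P * w − Q * v + (B′ − B))
      ≈⟨ trans (+-congˡ rest≈0) (+-identityʳ _) ⟩
    P * h₂ − Q * h₁ + B + a * (b * (h₂ + w))
      ∎
    where
    regroup : ∀ P Q B B′ a b h₁ h₂ v w →
      (P + a * b) * (h₂ + w) − Q * (h₁ + v) + B′
        ≈ (P * h₂ − Q * h₁ + B + a * (b * (h₂ + w))) + (P * w − Q * v + (B′ − B))
    regroup = solve 10 (λ P Q B B′ a b h₁ h₂ v w →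
      (P :+ a :* b) :* (h₂ :+ w) :- Q :* (h₁ :+ v) :+ B′
        := (P :* h₂ :- Q :* h₁ :+ B :+ a :* (b :* (h₂ :+ w))) :+ (P :* w :- Q :* v :+ (B′ :- B))) refl

  distribute-halving : ∀ {A C B h₁ h₂ t u} → ι 2 * t ≈ u →
    t * (ι 2 * A * h₂ − ι 2 * C * h₁ + B) ≈ ((A * u) * h₂ − (C * u) * h₁) + B * t
  distribute-halving {A} {C} {B} {h₁} {h₂} {t} {u} 2t≈u = begin
    t * (ι 2 * A * h₂ − ι 2 * C * h₁ + B)
      ≈⟨ solve 6 (λ A C B h₁ h₂ t →
           t :* (con (+ 2) :* A :* h₂ :- con (+ 2) :* C :* h₁ :+ B)
             := ((A :* (con (+ 2) :* t)) :* h₂ :- (C :* (con (+ 2) :* t)) :* h₁) :+ B :* t)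
           refl A C B h₁ h₂ t ⟩
    ((A * (ι 2 * t)) * h₂ − (C * (ι 2 * t)) * h₁) + B * t
      ≈⟨ +-congʳ (+-cong (*-congʳ (*-congˡ 2t≈u)) (-‿cong (*-congʳ (*-congˡ 2t≈u)))) ⟩
    ((A * u) * h₂ − (C * u) * h₁) + B * t
      ∎

module FieldLemmas {c ℓ} (F : CharZeroField c ℓ) where
  open CharZeroField F
  open import Relation.Binary.Reasoning.Setoid setoid

  cancelˡ : ∀ {a s t} → ¬ (a ≈ 0#) → a * s ≈ t → s ≈ a ⁻¹ * t
  cancelˡ {a} {s} {t} a≉0 as≈t = begin
    s                  ≈⟨ sym (*-identityˡ s) ⟩
    1# * s             ≈⟨ *-congʳ (sym (⁻¹-inverse a a≉0)) ⟩
    (a * a ⁻¹) * s     ≈⟨ *-congʳ (*-comm a (a ⁻¹)) ⟩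
    (a ⁻¹ * a) * s     ≈⟨ *-assoc (a ⁻¹) a s ⟩
    a ⁻¹ * (a * s)     ≈⟨ *-congˡ as≈t ⟩
    a ⁻¹ * t           ∎

  *-nonzero : ∀ {a b} → ¬ (a ≈ 0#) → ¬ (b ≈ 0#) → ¬ (a * b ≈ 0#)
  *-nonzero {a} a≉0 b≉0 ab≈0 = b≉0 (trans (cancelˡ a≉0 ab≈0) (zeroʳ (a ⁻¹)))

  ^-nonzero : ∀ {y} l → ¬ (y ≈ 0#) → ¬ (y ^ l ≈ 0#)
  ^-nonzero zero    y≉0 1≈0 = 0≉1 (sym 1≈0)
  ^-nonzero (suc l) y≉0     = *-nonzero y≉0 (^-nonzero l y≉0)

  ^-inverse : ∀ {y} l → ¬ (y ≈ 0#) → y ^ l * (y ^ l) ⁻¹ ≈ 1#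
  ^-inverse l y≉0 = ⁻¹-inverse _ (^-nonzero l y≉0)

  quotient-inverse : ∀ {a b c} → ¬ (a ≈ 0#) → ¬ (c ≈ 0#) → c ≈ b * a → b * c ⁻¹ ≈ a ⁻¹
  quotient-inverse {a} {b} {c} a≉0 c≉0 c≈ba = begin
    b * c ⁻¹                  ≈⟨ sym (trans (*-congˡ (⁻¹-inverse a a≉0)) (*-identityʳ _)) ⟩
    (b * c ⁻¹) * (a * a ⁻¹)   ≈⟨ sym (*-assoc _ _ _) ⟩
    ((b * c ⁻¹) * a) * a ⁻¹   ≈⟨ *-congʳ (trans (*-assoc _ _ _) (*-congˡ (*-comm _ _))) ⟩
    (b * (a * c ⁻¹)) * a ⁻¹   ≈⟨ *-congʳ (sym (*-assoc _ _ _)) ⟩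
    ((b * a) * c ⁻¹) * a ⁻¹   ≈⟨ *-congʳ (*-congʳ (sym c≈ba)) ⟩
    (c * c ⁻¹) * a ⁻¹         ≈⟨ *-congʳ (⁻¹-inverse c c≉0) ⟩
    1# * a ⁻¹                 ≈⟨ *-identityˡ _ ⟩
    a ⁻¹                      ∎

module Polynomials {c ℓ} (F : CharZeroField c ℓ) where
  open CharZeroField F
  open IntegerSolver commutativeRing

  κ : ∀ {m} → ℕ → Polynomial m
  κ k = con (+ k)

  -- Solver syntax in the variables x and N.  The unit is written p :^ 0,
  -- which denotes 1# itself (con (+ 1) would denote ι 1 = 1# + 0#).
  Aₚ : ∀ {m} → Polynomial m → Polynomial m → Polynomial m
  Aₚ x N = κ 6 :* x :^ 5 :+ κ 15 :* x :^ 4 :+ κ 10 :* x :^ 3 :- x :- N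
           :+ κ 10 :* N :^ 3 :+ κ 15 :* N :^ 4 :+ κ 6 :* N :^ 5

  Cₚ : ∀ {m} → Polynomial m → Polynomial m
  Cₚ x = κ 30 :* x :^ 2 :* (x :+ x :^ 0) :^ 2 :- x :^ 0

  Bₚ : ∀ {m} → Polynomial m → Polynomial m → Polynomial m
  Bₚ x N = (κ 48 :* x :^ 3 :+ κ 72 :* x :^ 2 :- κ 18 :* N :* x :^ 2 :+ κ 14 :* x
           :- κ 18 :* N :* x :+ κ 8 :* N :^ 2 :* x :- κ 5 :+ κ 2 :* N
           :+ κ 4 :* N :^ 2 :- κ 3 :* N :^ 3) :* N

  -- Their values; these unfold to the expressions written in the statement.
  A : Carrier → Carrier → Carrier
  A x N = ⟦ Aₚ (var Fin.zero) (var (Fin.suc Fin.zero)) ⟧ (x ∷ N ∷ [])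

  C : Carrier → Carrier
  C x = ⟦ Cₚ (var Fin.zero) ⟧ (x ∷ [])

  B : Carrier → Carrier → Carrier
  B x N = ⟦ Bₚ (var Fin.zero) (var (Fin.suc Fin.zero)) ⟧ (x ∷ N ∷ [])

  leading-coefficient : ∀ x N → ι 2 * A x (1# + N) ≈ ι 2 * A x N + ι 60 * (1# + N) ^ 4
  leading-coefficient = solve 2 (λ x N →
    κ 2 :* Aₚ x (N :^ 0 :+ N) := κ 2 :* Aₚ x N :+ κ 60 :* (N :^ 0 :+ N) :^ 4) refl

  lower-terms : ∀ x N →
    ι 2 * A x N − ι 2 * C x * (x + (1# + N)) + (B x (1# + N) − B x N) * (x + (1# + N)) ^ 2 ≈ 0#
  lower-terms = solve 2 (λ x N → let Y = x :+ (N :^ 0 :+ N) in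
    κ 2 :* Aₚ x N :- κ 2 :* Cₚ x :* Y :+ (Bₚ x (N :^ 0 :+ N) :- Bₚ x N) :* Y :^ 2 := κ 0) refl

  at-zero : ∀ x → ι 2 * A x 0# * 0# − ι 2 * C x * 0# + B x 0# ≈ 0#
  at-zero = solve 1 (λ x →
    κ 2 :* Aₚ x (κ 0) :* κ 0 :- κ 2 :* Cₚ x :* κ 0 :+ Bₚ x (κ 0) := κ 0) refl

module ScaledSum {c ℓ} (F : CharZeroField c ℓ) where
  open CharZeroField F
  open Harmonic F
  open RingLemmas commutativeRing
  open FieldLemmas F
  open Polynomials F

  closedForm : Carrier → ℕ → Carrier
  closedForm x n = ι 2 * A x (ι n) * H^ 2 n x − ι 2 * C x * H n x + B x (ι n)

  closedForm-step : ∀ x n → ¬ (x + ι (suc n) ≈ 0#) →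
    closedForm x (suc n) ≈ closedForm x n + ι 60 * (ι (suc n) ^ 4 * H^ 2 (suc n) x)
  closedForm-step x n Y≉0 =
    closed-form-step (leading-coefficient x (ι n))
      (partial-fractions (^-inverse 1 Y≉0) (^-inverse 2 Y≉0) (lower-terms x (ι n)))

  sixty-times-sum : ∀ x n → (∀ k → 1 ≤ k → k ≤ n → ¬ (x + ι k ≈ 0#)) →
    ι 60 * Σ₁ n (λ k → ι k ^ 4 * H^ 2 k x) ≈ closedForm x n
  sixty-times-sum x n x+k≉0 = trans (sym (Σ₁-*ˡ (ι 60) n (λ k → ι k ^ 4 * H^ 2 k x)))
    (Σ₁-telescope _ (closedForm x) (at-zero x) n
      (λ k k<n → closedForm-step x k (x+k≉0 (suc k) (s≤s z≤n) k<n)))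

proposition23 : ∀ {c ℓ} (F : CharZeroField c ℓ) → let open CharZeroField F in let open Harmonic F in
    ∀ (x : Carrier) (n : ℕ) →
    (∀ k → 1 ≤ k → k ≤ n → ¬ (x + ι k ≈ 0#)) →
    Σ₁ n (λ k → (ι k ^ 4) * H^ 2 k x)
      ≈ (((ι 6 * x ^ 5 + ι 15 * x ^ 4 + ι 10 * x ^ 3 − x − ι n
            + ι 10 * ι n ^ 3 + ι 15 * ι n ^ 4 + ι 6 * ι n ^ 5) * (ι 30) ⁻¹) * H^ 2 n x
        − ((ι 30 * x ^ 2 * (x + 1#) ^ 2 − 1#) * (ι 30) ⁻¹) * H n x)
        + ((ι 48 * x ^ 3 + ι 72 * x ^ 2 − ι 18 * ι n * x ^ 2 + ι 14 * x
            − ι 18 * ι n * x + ι 8 * ι n ^ 2 * x − ι 5 + ι 2 * ι n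
            + ι 4 * ι n ^ 2 − ι 3 * ι n ^ 3) * ι n) * (ι 60) ⁻¹
proposition23 F x n x+k≉0 =
  trans (cancelˡ (char0 59) (sixty-times-sum x n x+k≉0))
        (distribute-halving (quotient-inverse (char0 29) (char0 59) (ι-* 2 30)))
  where
  open CharZeroField F
  open IntegerSolver commutativeRing using (ι-*)
  open RingLemmas commutativeRing using (distribute-halving)
  open FieldLemmas F using (cancelˡ; quotient-inverse)
  open ScaledSum F using (sixty-times-sum)
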